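{- For any arch systems $A$ and $B$: if $\mathcal{C}_A \le \mathcal{C}_B$ then $\mathcal{C}_{\langle A\rangle} \le \mathcal{C}_{\langle B\rangle}$, and if $\mathcal{C}_A < \mathcal{C}_B$ then $\mathcal{C}_{\langle A\rangle} < \mathcal{C}_{\langle B\rangle}$.
   Context: An arch system of size $n$ is a set of $n$ non-crossing arches above a baseline connecting $2n$ points, each point an endpoint of exactly one arch; the empty system has size $0$. $B$ is contained in $A$ if obtainable from $A$ by deleting arches; $\mathrm{Av}(A)$ is the set of arch systems not containing $A$. Concatenation $AB$ places $B$ right of $A$. An atom is a non-empty arch system that is not a concatenation of two non-empty ones; every atom is $\langle A\rangle$, obtained from its contents $A$ by adding one enclosing arch. The relation $\sim$ is the finest equivalence relation on arch systems such that for all arch systems $A,B,P,Q$ and all $a,b,c$ each an atom or empty: (R1) $A\sim B\Rightarrow\langle A\rangle\sim\langle B\rangle$; (R2) $a\sim b\Rightarrow PaQ\sim PbQ$; (R3) $PabQ\sim PbaQ$; (R4) $a\langle bc\rangle\sim\langle ab\rangle c$. Equivalence classes of $\sim$ are cohorts; $\mathcal{C}_A$ is the cohort of $A$. For all $A,B$ in a common cohort, $\mathrm{Av}(A)$ and $\mathrm{Av}(B)$ have the same number of elements of each size; write $F_{\mathcal{C}}=\sum_n c_n t^n$ for this common generating function of the cohort $\mathcal{C}$ ($c_n$ = number of systems with $n$ arches avoiding any member of $\mathcal{C}$). For cohorts $\mathcal{C},\mathcal{D}$ with $F_{\mathcal{C}}=\sum c_nt^n$, $F_{\mathcal{D}}=\sum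 d_nt^n$: $\mathcal{C}\le\mathcal{D}$ means $c_n\le d_n$ for all $n$; $\mathcal{C}<\mathcal{D}$ means $\mathcal{C}\le\mathcal{D}$ and there is $n_0$ with $c_n<d_n$ for all $n\ge n_0$. -}

module Defs where

open import Data.Nat using (ℕ; zero; suc; _+_; _∸_; _≤_; _<_; _≥_)
open import Data.List using (List; []; _∷_; [_]; map; concatMap; length; filter; upTo)
open import Data.List.Membership.Propositional using (_∈_)
import Data.List.Membership.DecPropositional as DecMem
open import Data.Product using (∃; _×_; _,_)
open import Relation.Nullary using (¬_; Dec; yes; no)
open import Relation.Nullary.Decidable using (¬?)
open import Relation.Binary.Definitions using (DecidableEquality)
open import Relation.Binary.PropositionalEquality using (_≡_; refl; cong₂)

-- An arch system is a (plane) forest: either empty, or a first atom ⟨A⟩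
-- (with contents A) followed by the remaining arch system R.
data Arch : Set where
  ε    : Arch
  node : Arch → Arch → Arch

size : Arch → ℕ
size ε = 0
size (node A R) = suc (size A + size R)

infixr 5 _++_
_++_ : Arch → Arch → Arch
ε ++ B = B
node A R ++ B = node A (R ++ B)

⟨_⟩ : Arch → Arch
⟨ A ⟩ = node A ε

_≟_ : DecidableEquality Arch
ε ≟ ε = yes refl
ε ≟ node _ _ = no λ ()
node _ _ ≟ ε = no λ ()
node A R ≟ node A' R' with A ≟ A' | R ≟ R'
... | yes refl | yes refl = yes refl
... | no ¬p | _ = no λ { refl → ¬p refl }
... | yes _ | no ¬q = no λ { refl → ¬q refl }

open DecMem _≟_ using (_∈?_)

-- all arch systems obtainable from X by deleting any set of arches:
-- for the first atom ⟨A⟩ either keep its outer arch or delete it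
-- (deleting it leaves the contents in place), and recurse.
subs : Arch → List Arch
subs ε = [ ε ]
subs (node A R) =
  concatMap (λ a → concatMap (λ r → node a r ∷ (a ++ r) ∷ []) (subs R)) (subs A)

_⊑_ : Arch → Arch → Set
B ⊑ X = B ∈ subs X

_⊑?_ : (B X : Arch) → Dec (B ⊑ X)
B ⊑? X = B ∈? subs X

-- enumeration of all arch systems of a given size (first argument is fuel;
-- gen n n lists every arch system of size n exactly once)
gen : ℕ → ℕ → List Arch
gen _ zero = [ ε ]
gen zero (suc n) = []
gen (suc f) (suc n) =
  concatMap (λ i → concatMap (λ a → map (node a) (gen f (n ∸ i))) (gen f i))
            (upTo (suc n))

allOfSize : ℕ → List Arch
allOfSize n = gen n n

-- c_n for the cohort of A: number of arch systems with n arches avoiding A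
-- (by definition F_{C_A} is the generating function of Av(A))
avCount : Arch → ℕ → ℕ
avCount A n = length (filter (λ X → ¬? (A ⊑? X)) (allOfSize n))

_≤C_ : Arch → Arch → Set
A ≤C B = ∀ n → avCount A n ≤ avCount B n

_<C_ : Arch → Arch → Set
A <C B = A ≤C B × ∃ λ n₀ → ∀ n → n ≥ n₀ → avCount A n < avCount B n

module Submission where

-- An arch system ⟨a⟩r avoids ⟨A⟩ exactly when a avoids A and r avoids ⟨A⟩.
-- Splitting by the size of the first atom's contents therefore gives
--   c⟨A⟩(0) = 1,   c⟨A⟩(n+1) = Σ_{i ≤ n} c_A(i) · c⟨A⟩(n − i),
-- a recurrence that is monotone in c_A.  For strictness, the term i = n
-- alone already equals c_A(n), since c⟨A⟩(0) = 1.

open import Defs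
open import Data.Product using (_×_; ∃-syntax; _,_)
open import Data.Sum using (_⊎_; inj₁; inj₂)
open import Data.Nat using (ℕ; zero; suc; _+_; _*_; _∸_; _≤_; _<_; _≥_; z≤n; s≤s)
open import Data.Nat.Properties
open import Data.Nat.ListAction using (sum)
open import Data.List using (List; []; _∷_; map; concat; concatMap; length; filter; upTo)
  renaming (_++_ to _++ᴸ_)
open import Data.List.Properties using (length-++; filter-++; map-cong; map-cong-local)
open import Data.List.Membership.Propositional using (_∈_; find; lose)
open import Data.List.Membership.Propositional.Properties using (∈-concatMap⁺; ∈-concatMap⁻; ∈-upTo⁺)
open import Data.List.Relation.Unary.All using (All; []; _∷_)
open import Data.List.Relation.Unary.All.Properties using (applyUpTo⁺₁)
open import Data.List.Relation.Unary.Any using (here; there)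
open import Relation.Nullary using (¬_; yes; no; contradiction)
open import Relation.Nullary.Decidable using (¬?)
open import Relation.Binary.PropositionalEquality
  using (_≡_; refl; sym; trans; cong; cong₂; subst; subst₂; module ≡-Reasoning)

++-identityʳ : ∀ X → X ++ ε ≡ X
++-identityʳ ε = refl
++-identityʳ (node A R) = cong (node A) (++-identityʳ R)

node-⊑-node : ∀ {a r} x y → a ⊑ x → r ⊑ y → node a r ⊑ node x y
node-⊑-node x y a⊑x r⊑y =
  ∈-concatMap⁺ _ {xs = subs x} (lose a⊑x (∈-concatMap⁺ _ {xs = subs y} (lose r⊑y (here refl))))

++-⊑-node : ∀ {a r} x y → a ⊑ x → r ⊑ y → (a ++ r) ⊑ node x y
++-⊑-node x y a⊑x r⊑y =
  ∈-concatMap⁺ _ {xs = subs x} (lose a⊑x (∈-concatMap⁺ _ {xs = subs y} (lose r⊑y (there (here refl)))))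

⊑-node⁻ : ∀ {Z} x y → Z ⊑ node x y →
          ∃[ a ] ∃[ r ] a ⊑ x × r ⊑ y × (Z ≡ node a r ⊎ Z ≡ a ++ r)
⊑-node⁻ x y Z⊑ with find (∈-concatMap⁻ _ {xs = subs x} Z⊑)
... | a , a⊑x , Z∈ with find (∈-concatMap⁻ _ {xs = subs y} Z∈)
... | r , r⊑y , here eq = a , r , a⊑x , r⊑y , inj₁ eq
... | r , r⊑y , there (here eq) = a , r , a⊑x , r⊑y , inj₂ eq

ε⊑ : ∀ X → ε ⊑ X
ε⊑ ε = here refl
ε⊑ (node x y) = ++-⊑-node x y (ε⊑ x) (ε⊑ y)

⊑-nodeˡ : ∀ {A} x y → A ⊑ x → A ⊑ node x y
⊑-nodeˡ {A} x y A⊑x = subst (_⊑ node x y) (++-identityʳ A) (++-⊑-node x y A⊑x (ε⊑ y))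

⊑-nodeʳ : ∀ {A} x y → A ⊑ y → A ⊑ node x y
⊑-nodeʳ x y A⊑y = ++-⊑-node x y (ε⊑ x) A⊑y

⟨⟩⊑-node-cases : ∀ {A} x y → ⟨ A ⟩ ⊑ node x y → A ⊑ x ⊎ ⟨ A ⟩ ⊑ x ⊎ ⟨ A ⟩ ⊑ y
⟨⟩⊑-node-cases x y ⟨A⟩⊑ with ⊑-node⁻ x y ⟨A⟩⊑
... | _ , _ , a⊑x , _ , inj₁ refl = inj₁ a⊑x
... | ε , _ , _ , r⊑y , inj₂ refl = inj₂ (inj₂ r⊑y)
... | node _ ε , ε , a⊑x , _ , inj₂ refl = inj₂ (inj₁ a⊑x)
... | node _ ε , node _ _ , _ , _ , inj₂ ()
... | node _ (node _ _) , _ , _ , _ , inj₂ ()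

⟨⟩⊑⇒⊑ : ∀ {A} X → ⟨ A ⟩ ⊑ X → A ⊑ X
⟨⟩⊑⇒⊑ ε (here ())
⟨⟩⊑⇒⊑ ε (there ())
⟨⟩⊑⇒⊑ (node x y) ⟨A⟩⊑ with ⟨⟩⊑-node-cases x y ⟨A⟩⊑
... | inj₁ A⊑x = ⊑-nodeˡ x y A⊑x
... | inj₂ (inj₁ ⟨A⟩⊑x) = ⊑-nodeˡ x y (⟨⟩⊑⇒⊑ x ⟨A⟩⊑x)
... | inj₂ (inj₂ ⟨A⟩⊑y) = ⊑-nodeʳ x y (⟨⟩⊑⇒⊑ y ⟨A⟩⊑y)

⟨⟩⊑-node⁻ : ∀ {A} a r → ⟨ A ⟩ ⊑ node a r → A ⊑ a ⊎ ⟨ A ⟩ ⊑ r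
⟨⟩⊑-node⁻ a r ⟨A⟩⊑ with ⟨⟩⊑-node-cases a r ⟨A⟩⊑
... | inj₁ A⊑a = inj₁ A⊑a
... | inj₂ (inj₁ ⟨A⟩⊑a) = inj₁ (⟨⟩⊑⇒⊑ a ⟨A⟩⊑a)
... | inj₂ (inj₂ ⟨A⟩⊑r) = inj₂ ⟨A⟩⊑r

⟨⟩⊑-node⁺ : ∀ {A} a r → A ⊑ a ⊎ ⟨ A ⟩ ⊑ r → ⟨ A ⟩ ⊑ node a r
⟨⟩⊑-node⁺ a r (inj₁ A⊑a) = node-⊑-node a r A⊑a (ε⊑ r)
⟨⟩⊑-node⁺ a r (inj₂ ⟨A⟩⊑r) = ++-⊑-node a r (ε⊑ a) ⟨A⟩⊑r

countAvoiding : Arch → List Arch → ℕ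
countAvoiding A xs = length (filter (λ X → ¬? (A ⊑? X)) xs)

countAvoiding-++ : ∀ A xs ys → countAvoiding A (xs ++ᴸ ys) ≡ countAvoiding A xs + countAvoiding A ys
countAvoiding-++ A xs ys =
  trans (cong length (filter-++ (λ X → ¬? (A ⊑? X)) xs ys)) (length-++ (filter _ xs))

countAvoiding-concatMap : ∀ A (g : ℕ → List Arch) is →
  countAvoiding A (concatMap g is) ≡ sum (map (λ i → countAvoiding A (g i)) is)
countAvoiding-concatMap A g [] = refl
countAvoiding-concatMap A g (i ∷ is) =
  trans (countAvoiding-++ A (g i) (concatMap g is)) (cong (_ +_) (countAvoiding-concatMap A g is))

countAvoiding-map-node-⊑ : ∀ {A a} rs → A ⊑ a → countAvoiding ⟨ A ⟩ (map (node a) rs) ≡ 0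
countAvoiding-map-node-⊑ [] A⊑a = refl
countAvoiding-map-node-⊑ {A} {a} (r ∷ rs) A⊑a with ⟨ A ⟩ ⊑? node a r
... | yes _ = countAvoiding-map-node-⊑ rs A⊑a
... | no ⟨A⟩⋢ = contradiction (⟨⟩⊑-node⁺ a r (inj₁ A⊑a)) ⟨A⟩⋢

countAvoiding-map-node-⋢ : ∀ {A a} rs → ¬ A ⊑ a →
  countAvoiding ⟨ A ⟩ (map (node a) rs) ≡ countAvoiding ⟨ A ⟩ rs
countAvoiding-map-node-⋢ [] A⋢a = refl
countAvoiding-map-node-⋢ {A} {a} (r ∷ rs) A⋢a with ⟨ A ⟩ ⊑? node a r | ⟨ A ⟩ ⊑? r
... | yes _ | yes _ = countAvoiding-map-node-⋢ rs A⋢a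
... | no _ | no _ = cong suc (countAvoiding-map-node-⋢ rs A⋢a)
... | no ⟨A⟩⋢ | yes ⟨A⟩⊑r = contradiction (⟨⟩⊑-node⁺ a r (inj₂ ⟨A⟩⊑r)) ⟨A⟩⋢
... | yes ⟨A⟩⊑ | no ⟨A⟩⋢r with ⟨⟩⊑-node⁻ a r ⟨A⟩⊑
...   | inj₁ A⊑a = contradiction A⊑a A⋢a
...   | inj₂ ⟨A⟩⊑r = contradiction ⟨A⟩⊑r ⟨A⟩⋢r

nodes : List Arch → List Arch → List Arch
nodes as rs = concatMap (λ a → map (node a) rs) as

countAvoiding-⟨⟩-nodes : ∀ A as rs →
  countAvoiding ⟨ A ⟩ (nodes as rs) ≡ countAvoiding A as * countAvoiding ⟨ A ⟩ rs
countAvoiding-⟨⟩-nodes A [] rs = refl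
countAvoiding-⟨⟩-nodes A (a ∷ as) rs with A ⊑? a
... | yes A⊑a = trans (countAvoiding-++ ⟨ A ⟩ (map (node a) rs) _)
                      (cong₂ _+_ (countAvoiding-map-node-⊑ rs A⊑a) (countAvoiding-⟨⟩-nodes A as rs))
... | no A⋢a = trans (countAvoiding-++ ⟨ A ⟩ (map (node a) rs) _)
                     (cong₂ _+_ (countAvoiding-map-node-⋢ rs A⋢a) (countAvoiding-⟨⟩-nodes A as rs))

gen-fuel : ∀ {f g} n → n ≤ f → n ≤ g → gen f n ≡ gen g n
gen-fuel zero _ _ = refl
gen-fuel {suc f} {suc g} (suc n) (s≤s n≤f) (s≤s n≤g) =
  cong concat (map-cong-local (applyUpTo⁺₁ (λ i → i) (suc n) λ {i} i<1+n →
    let i≤n = ≤-pred i<1+n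
        n∸i≤n = m∸n≤m n i
    in cong₂ nodes
             (gen-fuel i (≤-trans i≤n n≤f) (≤-trans i≤n n≤g))
             (gen-fuel (n ∸ i) (≤-trans n∸i≤n n≤f) (≤-trans n∸i≤n n≤g))))

gen-allOfSize : ∀ {f} n → n ≤ f → gen f n ≡ allOfSize n
gen-allOfSize n n≤f = gen-fuel n n≤f ≤-refl

avCount-⟨⟩-zero : ∀ A → avCount ⟨ A ⟩ 0 ≡ 1
avCount-⟨⟩-zero A with ⟨ A ⟩ ⊑? ε
... | yes (here ())
... | yes (there ())
... | no _ = refl

-- Avoiders of ⟨A⟩ of size n + 1 whose first atom has contents of size i.
avSplit : Arch → ℕ → ℕ → ℕ
avSplit A n i = avCount A i * avCount ⟨ A ⟩ (n ∸ i)

avCount-⟨⟩-suc : ∀ A n → avCount ⟨ A ⟩ (suc n) ≡ sum (map (avSplit A n) (upTo (suc n)))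
avCount-⟨⟩-suc A n = begin
  countAvoiding ⟨ A ⟩ (gen (suc n) (suc n))
    ≡⟨ countAvoiding-concatMap ⟨ A ⟩ (λ i → nodes (gen n i) (gen n (n ∸ i))) (upTo (suc n)) ⟩
  sum (map (λ i → countAvoiding ⟨ A ⟩ (nodes (gen n i) (gen n (n ∸ i)))) (upTo (suc n)))
    ≡⟨ cong sum (map-cong (λ i → countAvoiding-⟨⟩-nodes A (gen n i) (gen n (n ∸ i))) (upTo (suc n))) ⟩
  sum (map (λ i → countAvoiding A (gen n i) * countAvoiding ⟨ A ⟩ (gen n (n ∸ i))) (upTo (suc n)))
    ≡⟨ cong sum (map-cong-local (applyUpTo⁺₁ (λ i → i) (suc n) λ {i} i<1+n →
         cong₂ (λ as rs → countAvoiding A as * countAvoiding ⟨ A ⟩ rs)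
               (gen-allOfSize i (≤-pred i<1+n)) (gen-allOfSize (n ∸ i) (m∸n≤m n i)))) ⟩
  sum (map (avSplit A n) (upTo (suc n)))
    ∎
  where open ≡-Reasoning

avSplit-last : ∀ A n → avSplit A n n ≡ avCount A n
avSplit-last A n = begin
  avCount A n * avCount ⟨ A ⟩ (n ∸ n) ≡⟨ cong (λ k → avCount A n * avCount ⟨ A ⟩ k) (n∸n≡0 n) ⟩
  avCount A n * avCount ⟨ A ⟩ 0       ≡⟨ cong (avCount A n *_) (avCount-⟨⟩-zero A) ⟩
  avCount A n * 1                     ≡⟨ *-identityʳ (avCount A n) ⟩
  avCount A n                         ∎
  where open ≡-Reasoning

sum-map-mono-≤ : ∀ {h k : ℕ → ℕ} {is} → All (λ i → h i ≤ k i) is → sum (map h is) ≤ sum (map k is)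
sum-map-mono-≤ [] = z≤n
sum-map-mono-≤ (h≤k ∷ hs≤ks) = +-mono-≤ h≤k (sum-map-mono-≤ hs≤ks)

sum-map-mono-< : ∀ {h k : ℕ → ℕ} {is j} → All (λ i → h i ≤ k i) is → j ∈ is → h j < k j →
                 sum (map h is) < sum (map k is)
sum-map-mono-< (_ ∷ hs≤ks) (here refl) hj<kj = +-mono-<-≤ hj<kj (sum-map-mono-≤ hs≤ks)
sum-map-mono-< (h≤k ∷ hs≤ks) (there j∈) hj<kj = +-mono-≤-< h≤k (sum-map-mono-< hs≤ks j∈ hj<kj)

avSplit-mono : ∀ {A B} n → A ≤C B → (∀ m → m ≤ n → avCount ⟨ A ⟩ m ≤ avCount ⟨ B ⟩ m) →
               All (λ i → avSplit A n i ≤ avSplit B n i) (upTo (suc n))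
avSplit-mono n A≤B ⟨A⟩≤⟨B⟩ = applyUpTo⁺₁ (λ i → i) (suc n) λ {i} _ →
  *-mono-≤ (A≤B i) (⟨A⟩≤⟨B⟩ (n ∸ i) (m∸n≤m n i))

⟨⟩-mono-≤C : ∀ {A B} → A ≤C B → ⟨ A ⟩ ≤C ⟨ B ⟩
⟨⟩-mono-≤C {A} {B} A≤B n = bounded n n ≤-refl
  where
  -- n ∸ i is not a structural subterm of suc n, so the induction runs on a bound f.
  bounded : ∀ f n → n ≤ f → avCount ⟨ A ⟩ n ≤ avCount ⟨ B ⟩ n
  bounded _ zero _ = ≤-reflexive (trans (avCount-⟨⟩-zero A) (sym (avCount-⟨⟩-zero B)))
  bounded (suc f) (suc n) (s≤s n≤f) =
    subst₂ _≤_ (sym (avCount-⟨⟩-suc A n)) (sym (avCount-⟨⟩-suc B n))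
      (sum-map-mono-≤ (avSplit-mono n A≤B λ m m≤n → bounded f m (≤-trans m≤n n≤f)))

⟨⟩-mono-<C : ∀ {A B} → A <C B → ⟨ A ⟩ <C ⟨ B ⟩
⟨⟩-mono-<C {A} {B} (A≤B , n₀ , A<B) = ⟨A⟩≤⟨B⟩ , suc n₀ , strict
  where
  ⟨A⟩≤⟨B⟩ : ⟨ A ⟩ ≤C ⟨ B ⟩
  ⟨A⟩≤⟨B⟩ = ⟨⟩-mono-≤C A≤B
  strict : ∀ n → n ≥ suc n₀ → avCount ⟨ A ⟩ n < avCount ⟨ B ⟩ n
  strict (suc n) (s≤s n≥n₀) =
    subst₂ _<_ (sym (avCount-⟨⟩-suc A n)) (sym (avCount-⟨⟩-suc B n))
      (sum-map-mono-< (avSplit-mono n A≤B λ m _ → ⟨A⟩≤⟨B⟩ m) (∈-upTo⁺ (n<1+n n))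
        (subst₂ _<_ (sym (avSplit-last A n)) (sym (avSplit-last B n)) (A<B n n≥n₀)))

mainTheorem9 : (A B : Arch) →
    ((A ≤C B) → (⟨ A ⟩ ≤C ⟨ B ⟩)) × ((A <C B) → (⟨ A ⟩ <C ⟨ B ⟩))
mainTheorem9 A B = ⟨⟩-mono-≤C , ⟨⟩-mono-<C
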